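{- In the setting described in the context, for every $i\in\mathcal A_0$, $$\alpha_i\le\left(1+\frac1\epsilon\right)^{\lfloor(d(r,i)-1)/2\rfloor}.$$
   Context: Model data: types $\mathcal A$ ($|\mathcal A|=n$), two-type matches $\mathcal M$ with rewards $r_m>0$ and incidence matrix $M$, arrival probabilities $\lambda_i>0$ with $\sum\lambda_i=1$. $\mathrm{SPP}(\lambda)$: maximize $r^\top z$ s.t. $Mz+s=\lambda$, $z,s\ge0$. GPG: it has a non-degenerate optimal basic solution $(z^*,s^*)$; $\epsilon=\min(\min_{z^*_m>0}z^*_m,\min_{s^*_i>0}s^*_i)$; $\mathcal M_+=\{m:z^*_m>0\}$, $\mathcal A_+=\{i:s^*_i>0\}$, $\mathcal A_0=\mathcal A\setminus\mathcal A_+$. Assume GPG and that $(\mathcal A,\mathcal M_+)$ is a tree; then $\mathcal A_+=\{r\}$; root the tree at $r$. $\mathrm{par}(i)$ is the parent, $m(i,j)$ the match of adjacent $i,j$, $d(i,j)$ the graph distance, $\mathcal T^-(j)$ the set of proper descendants of $j$, $\mathcal P(i)=\{j\in\mathcal A_0: i\in\mathcal T^-(j),\ d(j,i)\text{ even}\}$. Let $\epsilon_i=z^*_{m(i,\mathrm{par}(i))}$ for $i\in\mathcal A_0$ and $\epsilon_r=s^*_r$. Define recursively, for $i\in\mathcal A_0$, $\alpha_i=1+\frac{1}{\epsilon_i}\sum_{j\in\mathcal P(i)}\alpha_j(\lambda_j-\epsilon_j)$.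
   Formalization: The arrival probabilities $\lambda_i$, the rewards $r_m$ and the optimal basic solution $(z^*,s^*)$ take rational values, so $\epsilon$, $\epsilon_i$ and $\alpha_i$ are rational as well. -}

module Defs where

open import Data.Nat as ℕ using (ℕ; zero; suc)
open import Data.Nat.DivMod using (_/_; _%_)
open import Data.Fin using (Fin; zero; suc)
import Data.Fin as Fin
open import Data.Bool using (Bool; true; false; if_then_else_; _∨_)
open import Data.Rational as ℚ using (ℚ; 0ℚ; 1ℚ; _+_; _*_; _-_; _≤_; _<_; 1/_; ≢-nonZero)
open import Data.Rational.Properties using (_≟_)
open import Data.List using (List; map; foldr)
open import Data.List.Relation.Unary.Unique.Propositional using (Unique)
open import Data.List.Membership.Propositional using (_∈_)
open import Data.Product using (Σ; ∃; _×_; _,_; proj₁; proj₂)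
open import Data.Sum using (_⊎_)
open import Relation.Nullary using (¬_; yes; no; does)
open import Relation.Binary.PropositionalEquality using (_≡_; _≢_)
open import Function.Bundles using (_⇔_)

sumᶠ : ∀ {k} → (Fin k → ℚ) → ℚ
sumᶠ {zero}  f = 0ℚ
sumᶠ {suc k} f = f zero + sumᶠ (λ x → f (suc x))

countᶠ : ∀ {k} → (Fin k → Bool) → ℕ
countᶠ {zero}  f = 0
countᶠ {suc k} f = (if f zero then 1 else 0) ℕ.+ countᶠ (λ x → f (suc x))

sumL : ∀ {A : Set} → (A → ℚ) → List A → ℚ
sumL f xs = foldr (λ x acc → f x + acc) 0ℚ (xs)

pow : ℚ → ℕ → ℚ
pow q zero    = 1ℚ
pow q (suc k) = q * pow q k

-- 1/q for q ≠ 0 (only ever applied to positive numbers below)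
recip : ℚ → ℚ
recip q with q ≟ 0ℚ
... | yes _  = 0ℚ
... | no q≢0 = 1/_ q {{≢-nonZero q≢0}}

-- Model data: n types, k two-type matches

record Model (n k : ℕ) : Set where
  field
    ends      : Fin k → Fin n × Fin n
    twoType   : ∀ m → proj₁ (ends m) ≢ proj₂ (ends m)
    reward    : Fin k → ℚ
    rewardPos : ∀ m → 0ℚ < reward m
    arr       : Fin n → ℚ                      -- λ_i
    arrPos    : ∀ i → 0ℚ < arr i
    arrSum    : sumᶠ arr ≡ 1ℚ

module _ {n k : ℕ} (D : Model n k) where
  open Model D

  inc : Fin n → Fin k → ℚ
  inc i m = if does (i Fin.≟ proj₁ (ends m)) ∨ does (i Fin.≟ proj₂ (ends m)) then 1ℚ else 0ℚ

  Mz : (Fin k → ℚ) → Fin n → ℚ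
  Mz z i = sumᶠ (λ m → inc i m * z m)

  Feasible : (Fin k → ℚ) → (Fin n → ℚ) → Set
  Feasible z s = (∀ i → Mz z i + s i ≡ arr i) × (∀ m → 0ℚ ≤ z m) × (∀ i → 0ℚ ≤ s i)

  Optimal : (Fin k → ℚ) → (Fin n → ℚ) → Set
  Optimal z s = Feasible z s ×
    (∀ z' s' → Feasible z' s' → sumᶠ (λ m → reward m * z' m) ≤ sumᶠ (λ m → reward m * z m))

  -- basic solution: the columns of [M I] of the positive variables are
  -- linearly independent
  Basic : (Fin k → ℚ) → (Fin n → ℚ) → Set
  Basic z s = ∀ (c : Fin k → ℚ) (d : Fin n → ℚ) →
    (∀ m → c m ≢ 0ℚ → 0ℚ < z m) → (∀ i → d i ≢ 0ℚ → 0ℚ < s i) →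
    (∀ i → Mz c i + d i ≡ 0ℚ) → (∀ m → c m ≡ 0ℚ) × (∀ i → d i ≡ 0ℚ)

  NonDegenerate : (Fin k → ℚ) → (Fin n → ℚ) → Set
  NonDegenerate z s =
    countᶠ (λ m → does (0ℚ ℚ.<? z m)) ℕ.+ countᶠ (λ i → does (0ℚ ℚ.<? s i)) ≡ n

  Links : Fin k → Fin n → Fin n → Set
  Links m i j = ends m ≡ (i , j) ⊎ ends m ≡ (j , i)

  data Walk (E : Fin k → Set) : Fin n → Fin n → Set where
    here : ∀ {i} → Walk E i i
    step : ∀ {i j l} (m : Fin k) → E m → Links m i j → Walk E j l → Walk E i l

  walkLength : ∀ {E i j} → Walk E i j → ℕ
  walkLength here             = 0
  walkLength (step _ _ _ w)   = suc (walkLength w)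

  Connected : (Fin k → Set) → Set
  Connected E = ∀ i j → Walk E i j

  IsTree : (Fin k → Set) → Set
  IsTree E = Connected E ×
    (∀ m → E m → ¬ Connected (λ m' → E m' × m' ≢ m))

  Dist : (Fin k → Set) → Fin n → Fin n → ℕ → Set
  Dist E i j d = (Σ (Walk E i j) λ w → walkLength w ≡ d) ×
                 (∀ (w : Walk E i j) → d ℕ.≤ walkLength w)

  module Rooted (E : Fin k → Set) (ρ : Fin n) where

    Par : Fin n → Fin n → Set
    Par i p = (∃ λ m → E m × Links m i p) ×
              (∃ λ d → Dist E ρ p d × Dist E ρ i (suc d))

    data ProperDesc : Fin n → Fin n → Set where
      one  : ∀ {i j} → Par i j → ProperDesc i j
      more : ∀ {i p j} → Par i p → ProperDesc p j → ProperDesc i j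

module Quantities {n k : ℕ} (D : Model n k)
                  (z : Fin k → ℚ) (s : Fin n → ℚ) (ρ : Fin n) where
  open Model D

  Mplus : Fin k → Set
  Mplus m = 0ℚ < z m

  Aplus : Fin n → Set
  Aplus i = 0ℚ < s i

  A0 : Fin n → Set
  A0 i = ¬ Aplus i

  open Rooted D Mplus ρ public

  PP : Fin n → Fin n → Set
  PP i j = A0 j × ProperDesc i j × (∃ λ d → Dist D Mplus j i d × d % 2 ≡ 0)

  IsEpsilon : ℚ → Set
  IsEpsilon e = (∀ m → Mplus m → e ≤ z m) × (∀ i → Aplus i → e ≤ s i) ×
                ((∃ λ m → Mplus m × e ≡ z m) ⊎ (∃ λ i → Aplus i × e ≡ s i))

  IsEpsFun : (Fin n → ℚ) → Set
  IsEpsFun ef = (ef ρ ≡ s ρ) ×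
    (∀ i p m → A0 i → Par i p → Mplus m → Links D m i p → ef i ≡ z m)

  IsAlpha : (Fin n → ℚ) → (Fin n → ℚ) → Set
  IsAlpha ef α = ∀ i → A0 i → ∀ (L : List (Fin n)) → Unique L →
    (∀ j → (j ∈ L) ⇔ PP i j) →
    α i ≡ 1ℚ + recip (ef i) * sumL (λ j → α j * (arr j - ef j)) L

{-# OPTIONS --safe #-}
-- Every j ∈ 𝒫(i) is a proper ancestor of i at even distance, hence not its parent, so
-- d(r,j) ≤ d(r,i) - 2. By strong induction on d = d(r,i), every such α_j is then at most
-- P = (1 + 1/ε)^⌊(d-3)/2⌋. Feasibility gives ε ≤ ε_j ≤ λ_j, as ε_j is the rate of a match
-- containing j, and with Σ_j λ_j ≤ 1 and P ≥ 1 this yields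
--   α_i ≤ 1 + (1/ε_i) P Σ_j λ_j ≤ 1 + P/ε ≤ (1 + 1/ε) P = (1 + 1/ε)^⌊(d-1)/2⌋.
-- If 𝒫(i) is empty, α_i = 1.
module Submission where

open import Defs
open import Data.Nat using (ℕ; _∸_)
open import Data.Nat.DivMod using (_/_)
open import Data.Fin using (Fin)
open import Data.Rational using (ℚ; 0ℚ; 1ℚ; _+_; _≤_; _<_)

import Data.Nat as ℕ
import Data.Nat.Properties as ℕₚ
open import Data.Nat using (zero; suc; z≤n; s≤s)
open import Data.Nat.DivMod using (_%_; /-monoˡ-≤; m/n≡1+[m∸n]/n)
open import Data.Nat.Induction using (<-rec)
open import Data.Fin using (zero; suc)
open import Data.Fin.Properties using (sequence)
import Data.Fin.Properties as Finₚ
import Data.Rational as ℚ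
open import Data.Rational using (_*_; _-_; -_; 1/_)
import Data.Rational.Properties as ℚₚ
open import Data.Bool using (true; false; _∨_)
open import Data.Bool.Properties using (∨-zeroʳ)
open import Data.Vec.Functional using (updateAt)
open import Data.Vec.Functional.Properties using (updateAt-updates; updateAt-minimal)
open import Data.List using (List; []; _∷_; filter; allFin)
open import Data.List.Relation.Unary.All using (All; []; _∷_)
open import Data.List.Relation.Unary.Any using (here; there)
open import Data.List.Relation.Unary.AllPairs using (_∷_)
open import Data.List.Relation.Unary.Unique.Propositional using (Unique)
import Data.List.Relation.Unary.Unique.Propositional.Properties as Uniqueₚ
open import Data.List.Membership.Propositional using (_∈_)
import Data.List.Membership.Propositional.Properties as ∈ₚ
open import Data.Product using (Σ; ∃; _×_; _,_; proj₁; proj₂)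
open import Data.Sum using (inj₁; inj₂; [_,_])
open import Data.Empty using (⊥-elim)
open import Effect.Monad using (RawMonad)
open import Function using (_∘_; const)
open import Function.Bundles using (_⇔_; mk⇔; Equivalence)
open import Relation.Nullary using (¬_; Dec; yes; no; does)
open import Relation.Nullary.Decidable using (decidable-stable; dec-true; ¬¬-excluded-middle)
open import Relation.Nullary.Negation using (¬¬-Monad; ¬¬-map)
open import Relation.Binary.PropositionalEquality
  using (_≡_; _≢_; refl; sym; trans; cong; cong₂; subst; module ≡-Reasoning)

p≤p+q : ∀ {p q} → 0ℚ ≤ q → p ≤ p + q
p≤p+q {p} {q} 0≤q = subst (_≤ p + q) (ℚₚ.+-identityʳ p) (ℚₚ.+-monoʳ-≤ p 0≤q)

+-nonNeg : ∀ {p q} → 0ℚ ≤ p → 0ℚ ≤ q → 0ℚ ≤ p + q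
+-nonNeg {p} 0≤p 0≤q = ℚₚ.≤-trans 0≤p (p≤p+q 0≤q)

*-nonNeg : ∀ {p q} → 0ℚ ≤ p → 0ℚ ≤ q → 0ℚ ≤ p * q
*-nonNeg {p} {q} 0≤p 0≤q = ℚₚ.nonNegative⁻¹ (p * q)
  {{ℚₚ.nonNeg*nonNeg⇒nonNeg p {{ℚ.nonNegative 0≤p}} q {{ℚ.nonNegative 0≤q}}}}

p≤q⇒0≤q-p : ∀ {p q} → p ≤ q → 0ℚ ≤ q - p
p≤q⇒0≤q-p {p} {q} p≤q = subst (_≤ q - p) (ℚₚ.+-inverseʳ p) (ℚₚ.+-monoˡ-≤ (- p) p≤q)

0≤q⇒p-q≤p : ∀ {p q} → 0ℚ ≤ q → p - q ≤ p
0≤q⇒p-q≤p {p} {q} 0≤q = subst (p - q ≤_) (ℚₚ.+-identityʳ p) (ℚₚ.+-monoʳ-≤ p (ℚₚ.neg-antimono-≤ 0≤q))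

0≤1 : 0ℚ ≤ 1ℚ
0≤1 = ℚₚ.<⇒≤ (ℚₚ.positive⁻¹ 1ℚ)

recip-pos : ∀ {q} (0<q : 0ℚ < q) → recip q ≡ (1/ q) {{ℚₚ.pos⇒nonZero q {{ℚ.positive 0<q}}}}
recip-pos {q} 0<q with q ℚₚ.≟ 0ℚ
... | yes q≡0 = ⊥-elim (ℚₚ.<-irrefl (sym q≡0) 0<q)
... | no _ = refl

recip-nonNeg : ∀ {q} → 0ℚ < q → 0ℚ ≤ recip q
recip-nonNeg {q} 0<q rewrite recip-pos 0<q =
  ℚₚ.<⇒≤ (ℚₚ.positive⁻¹ _ {{ℚₚ.1/pos⇒pos q {{ℚ.positive 0<q}}}})

1/-antimono-≤-pos : ∀ {p q} .{{_ : ℚ.Positive p}} .{{_ : ℚ.Positive q}} → p ≤ q →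
  (1/ q) {{ℚₚ.pos⇒nonZero q}} ≤ (1/ p) {{ℚₚ.pos⇒nonZero p}}
1/-antimono-≤-pos {p} {q} p≤q = begin
    1/q               ≡⟨ sym (ℚₚ.*-identityʳ 1/q) ⟩
    1/q * 1ℚ          ≡⟨ cong (1/q *_) (sym (ℚₚ.*-inverseʳ p {{ℚₚ.pos⇒nonZero p}})) ⟩
    1/q * (p * 1/p)   ≡⟨ sym (ℚₚ.*-assoc 1/q p 1/p) ⟩
    1/q * p * 1/p     ≤⟨ ℚₚ.*-monoʳ-≤-nonNeg 1/p {{ℚₚ.pos⇒nonNeg 1/p {{ℚₚ.1/pos⇒pos p}}}}
                           (ℚₚ.*-monoˡ-≤-nonNeg 1/q {{ℚₚ.pos⇒nonNeg 1/q {{ℚₚ.1/pos⇒pos q}}}} p≤q) ⟩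
    1/q * q * 1/p     ≡⟨ cong (_* 1/p) (ℚₚ.*-inverseˡ q {{ℚₚ.pos⇒nonZero q}}) ⟩
    1ℚ * 1/p          ≡⟨ ℚₚ.*-identityˡ 1/p ⟩
    1/p               ∎
  where
  open ℚₚ.≤-Reasoning
  1/p = (1/ p) {{ℚₚ.pos⇒nonZero p}}
  1/q = (1/ q) {{ℚₚ.pos⇒nonZero q}}

recip-antimono : ∀ {p q} → 0ℚ < p → p ≤ q → recip q ≤ recip p
recip-antimono {p} {q} 0<p p≤q
  rewrite recip-pos 0<p | recip-pos (ℚₚ.<-≤-trans 0<p p≤q) =
  1/-antimono-≤-pos {{ℚ.positive 0<p}} {{ℚ.positive (ℚₚ.<-≤-trans 0<p p≤q)}} p≤q

1+r*s≤[1+c]*p : ∀ {r c s p} → 0ℚ ≤ r → r ≤ c → s ≤ p → 1ℚ ≤ p → 1ℚ + r * s ≤ (1ℚ + c) * p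
1+r*s≤[1+c]*p {r} {c} {s} {p} 0≤r r≤c s≤p 1≤p = begin
  1ℚ + r * s         ≤⟨ ℚₚ.+-monoʳ-≤ 1ℚ (ℚₚ.*-monoˡ-≤-nonNeg r {{ℚ.nonNegative 0≤r}} s≤p) ⟩
  1ℚ + r * p         ≤⟨ ℚₚ.+-mono-≤ 1≤p (ℚₚ.*-monoʳ-≤-nonNeg p {{ℚ.nonNegative 0≤p}} r≤c) ⟩
  p + c * p          ≡⟨ cong (_+ c * p) (sym (ℚₚ.*-identityˡ p)) ⟩
  1ℚ * p + c * p     ≡⟨ sym (ℚₚ.*-distribʳ-+ p 1ℚ c) ⟩
  (1ℚ + c) * p       ∎
  where
  open ℚₚ.≤-Reasoning
  0≤p = ℚₚ.≤-trans 0≤1 1≤p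

1≤pow : ∀ {b} → 1ℚ ≤ b → ∀ k → 1ℚ ≤ pow b k
1≤pow 1≤b zero    = ℚₚ.≤-refl
1≤pow {b} 1≤b (suc k) = ℚₚ.≤-trans 1≤b (subst (_≤ b * pow b k) (ℚₚ.*-identityʳ b)
  (ℚₚ.*-monoˡ-≤-nonNeg b {{ℚ.nonNegative (ℚₚ.≤-trans 0≤1 1≤b)}} (1≤pow 1≤b k)))

pow-monoʳ-≤ : ∀ {b} → 1ℚ ≤ b → ∀ {k l} → k ℕ.≤ l → pow b k ≤ pow b l
pow-monoʳ-≤ 1≤b {l = l} z≤n = 1≤pow 1≤b l
pow-monoʳ-≤ {b} 1≤b (s≤s k≤l) =
  ℚₚ.*-monoˡ-≤-nonNeg b {{ℚ.nonNegative (ℚₚ.≤-trans 0≤1 1≤b)}} (pow-monoʳ-≤ 1≤b k≤l)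

erase : ∀ {k} → (Fin k → ℚ) → Fin k → Fin k → ℚ
erase f x = updateAt f x (const 0ℚ)

erase-nonNeg : ∀ {k} {f : Fin k → ℚ} → (∀ y → 0ℚ ≤ f y) → ∀ x y → 0ℚ ≤ erase f x y
erase-nonNeg {f = f} 0≤f x y with y Finₚ.≟ x
... | yes refl = ℚₚ.≤-reflexive (sym (updateAt-updates x f))
... | no y≢x   = subst (0ℚ ≤_) (sym (updateAt-minimal y x f y≢x)) (0≤f y)

sumᶠ-nonNeg : ∀ {k} {f : Fin k → ℚ} → (∀ x → 0ℚ ≤ f x) → 0ℚ ≤ sumᶠ f
sumᶠ-nonNeg {zero}  _   = ℚₚ.≤-refl
sumᶠ-nonNeg {suc k} 0≤f = +-nonNeg (0≤f zero) (sumᶠ-nonNeg (0≤f ∘ suc))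

sumᶠ-erase : ∀ {k} (f : Fin k → ℚ) x → sumᶠ f ≡ f x + sumᶠ (erase f x)
sumᶠ-erase f zero    = cong (f zero +_) (sym (ℚₚ.+-identityˡ _))
sumᶠ-erase f (suc x) = begin
    f zero + sumᶠ (f ∘ suc)           ≡⟨ cong (f zero +_) (sumᶠ-erase (f ∘ suc) x) ⟩
    f zero + (f (suc x) + rest)       ≡⟨ sym (ℚₚ.+-assoc (f zero) (f (suc x)) rest) ⟩
    f zero + f (suc x) + rest         ≡⟨ cong (_+ rest) (ℚₚ.+-comm (f zero) (f (suc x))) ⟩
    f (suc x) + f zero + rest         ≡⟨ ℚₚ.+-assoc (f (suc x)) (f zero) rest ⟩
    f (suc x) + (f zero + rest)       ∎
  where
  open ≡-Reasoning
  rest = sumᶠ (erase (f ∘ suc) x)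

term≤sumᶠ : ∀ {k} {f : Fin k → ℚ} → (∀ y → 0ℚ ≤ f y) → ∀ x → f x ≤ sumᶠ f
term≤sumᶠ {f = f} 0≤f x =
  subst (f x ≤_) (sym (sumᶠ-erase f x)) (p≤p+q (sumᶠ-nonNeg (erase-nonNeg 0≤f x)))

sumL-erase-∉ : ∀ {k} (f : Fin k → ℚ) {x} L → All (x ≢_) L → sumL (erase f x) L ≡ sumL f L
sumL-erase-∉ f []      []          = refl
sumL-erase-∉ f (y ∷ L) (x≢y ∷ x∉L) =
  cong₂ _+_ (updateAt-minimal y _ f (x≢y ∘ sym)) (sumL-erase-∉ f L x∉L)

sumL≤sumᶠ : ∀ {k} {f : Fin k → ℚ} → (∀ y → 0ℚ ≤ f y) → ∀ L → Unique L → sumL f L ≤ sumᶠ f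
sumL≤sumᶠ 0≤f []      _               = sumᶠ-nonNeg 0≤f
sumL≤sumᶠ {f = f} 0≤f (x ∷ L) (x∉L ∷ uniq) = begin
    f x + sumL f L              ≡⟨ cong (f x +_) (sym (sumL-erase-∉ f L x∉L)) ⟩
    f x + sumL (erase f x) L    ≤⟨ ℚₚ.+-monoʳ-≤ (f x) (sumL≤sumᶠ (erase-nonNeg 0≤f x) L uniq) ⟩
    f x + sumᶠ (erase f x)      ≡⟨ sym (sumᶠ-erase f x) ⟩
    sumᶠ f                      ∎
  where open ℚₚ.≤-Reasoning

sumL-≤-* : ∀ {A : Set} (f g : A → ℚ) c L → (∀ {x} → x ∈ L → f x ≤ c * g x) →
  sumL f L ≤ c * sumL g L
sumL-≤-* f g c []      _     = ℚₚ.≤-reflexive (sym (ℚₚ.*-zeroʳ c))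
sumL-≤-* f g c (x ∷ L) f≤cg = begin
    f x + sumL f L            ≤⟨ ℚₚ.+-mono-≤ (f≤cg (here refl)) (sumL-≤-* f g c L (f≤cg ∘ there)) ⟩
    c * g x + c * sumL g L    ≡⟨ sym (ℚₚ.*-distribˡ-+ c (g x) (sumL g L)) ⟩
    c * (g x + sumL g L)      ∎
  where open ℚₚ.≤-Reasoning

enumerate : ∀ {n} {P : Fin n → Set} → (∀ j → Dec (P j)) →
  Σ (List (Fin n)) λ L → Unique L × (∀ j → (j ∈ L) ⇔ P j)
enumerate {n} P? = filter P? (allFin n) , Uniqueₚ.filter⁺ P? (Uniqueₚ.allFin⁺ n) , λ j →
  mk⇔ (proj₂ ∘ ∈ₚ.∈-filter⁻ P? {xs = allFin n}) (∈ₚ.∈-filter⁺ P? (∈ₚ.∈-allFin j))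

¬¬-decidable : ∀ {n} (P : Fin n → Set) → ¬ ¬ (∀ j → Dec (P j))
¬¬-decidable P = sequence (RawMonad.rawApplicative ¬¬-Monad) (λ _ → ¬¬-excluded-middle)

module _ {n k} (D : Model n k) where
  open Model D

  Links-sym : ∀ {m a b} → Links D m a b → Links D m b a
  Links-sym = [ inj₂ , inj₁ ]

  inc-nonNeg : ∀ i m → 0ℚ ≤ inc D i m
  inc-nonNeg i m with does (i Finₚ.≟ proj₁ (ends m)) ∨ does (i Finₚ.≟ proj₂ (ends m))
  ... | true  = 0≤1
  ... | false = ℚₚ.≤-refl

  inc-Links : ∀ {m i p} → Links D m i p → inc D i m ≡ 1ℚ
  inc-Links {m} {i} (inj₁ ends≡ip)
    rewrite dec-true (i Finₚ.≟ proj₁ (ends m)) (cong proj₁ (sym ends≡ip)) = refl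
  inc-Links {m} {i} (inj₂ ends≡pi)
    rewrite dec-true (i Finₚ.≟ proj₂ (ends m)) (cong proj₂ (sym ends≡pi))
          | ∨-zeroʳ (does (i Finₚ.≟ proj₁ (ends m))) = refl

  match≤arr : ∀ {z s} → Feasible D z s → ∀ {m i p} → Links D m i p → z m ≤ arr i
  match≤arr {z} {s} (Mz+s≡λ , 0≤z , 0≤s) {m} {i} lk = begin
      z m               ≡⟨ sym (ℚₚ.*-identityˡ (z m)) ⟩
      1ℚ * z m          ≡⟨ cong (_* z m) (sym (inc-Links lk)) ⟩
      inc D i m * z m   ≤⟨ term≤sumᶠ (λ m' → *-nonNeg (inc-nonNeg i m') (0≤z m')) m ⟩
      Mz D z i          ≤⟨ p≤p+q (0≤s i) ⟩
      Mz D z i + s i    ≡⟨ Mz+s≡λ i ⟩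
      arr i             ∎
    where open ℚₚ.≤-Reasoning

module WalkProperties {n k} (D : Model n k) (E : Fin k → Set) where

  snoc : ∀ {a p b} → Walk D E a p → ∀ m → E m → Links D m p b → Walk D E a b
  snoc here               m em lk = step m em lk here
  snoc (step m′ em′ lk′ w) m em lk = step m′ em′ lk′ (snoc w m em lk)

  walkLength-snoc : ∀ {a p b} (w : Walk D E a p) m (em : E m) (lk : Links D m p b) →
    walkLength D (snoc w m em lk) ≡ suc (walkLength D w)
  walkLength-snoc here           m em lk = refl
  walkLength-snoc (step _ _ _ w) m em lk = cong suc (walkLength-snoc w m em lk)

  lastEdge : ∀ {a c b} m → E m → Links D m a c → (w : Walk D E c b) →
    ∃ λ p → ∃ λ m′ → E m′ × Links D m′ p b ×
      Σ (Walk D E a p) λ w′ → walkLength D w′ ≡ walkLength D w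
  lastEdge m em lk here = _ , m , em , lk , here , refl
  lastEdge m em lk (step m₂ em₂ lk₂ w) with lastEdge m₂ em₂ lk₂ w
  ... | p , m′ , em′ , lk′ , w′ , len = p , m′ , em′ , lk′ , step m em lk w′ , cong suc len

  Dist-unique : ∀ {a b d₁ d₂} → Dist D E a b d₁ → Dist D E a b d₂ → d₁ ≡ d₂
  Dist-unique ((w₁ , len₁) , min₁) ((w₂ , len₂) , min₂) =
    ℕₚ.≤-antisym (subst (_ ℕ.≤_) len₂ (min₁ w₂)) (subst (_ ℕ.≤_) len₁ (min₂ w₁))

  Dist-zero⇒≡ : ∀ {a b} → Dist D E a b 0 → a ≡ b
  Dist-zero⇒≡ ((here , _) , _) = refl

  Dist-adjacent≤1 : ∀ {a b d m} → E m → Links D m a b → Dist D E a b d → d ℕ.≤ 1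
  Dist-adjacent≤1 em lk (_ , min) = min (step _ em lk here)

  Dist-suc⇒closerNeighbour : ∀ {a b d} → Dist D E a b (suc d) →
    ∃ λ p → ∃ λ m → E m × Links D m b p × Dist D E a p d
  Dist-suc⇒closerNeighbour ((step m em lk w , len) , min) with lastEdge m em lk w
  ... | p , m′ , em′ , lk′ , w′ , len′ =
    p , m′ , em′ , Links-sym D lk′ , (w′ , trans len′ (ℕₚ.suc-injective len)) , λ w″ →
      ℕₚ.≤-pred (ℕₚ.≤-trans (min (snoc w″ m′ em′ lk′)) (ℕₚ.≤-reflexive (walkLength-snoc w″ m′ em′ lk′)))

module RootedProperties {n k} (D : Model n k) (E : Fin k → Set) (ρ : Fin n) where
  open Rooted D E ρ
  open WalkProperties D E

  ProperDesc⇒closer : ∀ {i j d} → ProperDesc i j → Dist D E ρ i d →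
    ∃ λ d′ → Dist D E ρ j d′ × d′ ℕ.< d
  ProperDesc⇒closer (one (_ , d′ , ρj , ρi)) ρi′ = d′ , ρj , ℕₚ.≤-reflexive (Dist-unique ρi ρi′)
  ProperDesc⇒closer (more (_ , _ , ρp , ρi) desc) ρi′ with ProperDesc⇒closer desc ρp
  ... | d′ , ρj , d′<dp = d′ , ρj , ℕₚ.<-trans d′<dp (ℕₚ.≤-reflexive (Dist-unique ρi ρi′))

  Par⇒Dist≡1 : ∀ {i p d} → Par i p → Dist D E p i d → d ≡ 1
  Par⇒Dist≡1 {d = zero} (_ , _ , ρp , ρi) pi with Dist-zero⇒≡ pi
  ... | refl = ⊥-elim (ℕₚ.1+n≢n (Dist-unique ρi ρp))
  Par⇒Dist≡1 {d = suc zero}    _                     _  = refl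
  Par⇒Dist≡1 {d = suc (suc _)} ((_ , em , lk) , _) pi with Dist-adjacent≤1 em (Links-sym D lk) pi
  ... | s≤s ()

  evenProperDesc⇒closer : ∀ {i j d d′} → ProperDesc i j → Dist D E j i d′ → d′ % 2 ≡ 0 →
    Dist D E ρ i d → ∃ λ dj → Dist D E ρ j dj × 2 ℕ.+ dj ℕ.≤ d
  evenProperDesc⇒closer (one par) ji even _ with Par⇒Dist≡1 par ji
  evenProperDesc⇒closer (one par) ji () _ | refl
  evenProperDesc⇒closer (more (_ , _ , ρp , ρi) desc) _ _ ρi′ with ProperDesc⇒closer desc ρp
  ... | dj , ρj , dj<dp = dj , ρj , ℕₚ.≤-trans (s≤s dj<dp) (ℕₚ.≤-reflexive (Dist-unique ρi ρi′))

[a∸1]/2≤[b∸3]/2 : ∀ {a b} → 2 ℕ.+ a ℕ.≤ b → (a ∸ 1) / 2 ℕ.≤ (b ∸ 3) / 2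
[a∸1]/2≤[b∸3]/2 (s≤s (s≤s a≤b)) = /-monoˡ-≤ 2 (ℕₚ.∸-monoˡ-≤ 1 a≤b)

1+[b∸3]/2≡[b∸1]/2 : ∀ {b} → 3 ℕ.≤ b → suc ((b ∸ 3) / 2) ≡ (b ∸ 1) / 2
1+[b∸3]/2≡[b∸1]/2 {suc (suc (suc b))} (s≤s (s≤s (s≤s _))) = sym (m/n≡1+[m∸n]/n {2 ℕ.+ b} (s≤s (s≤s z≤n)))

module AlphaBound {n k} (D : Model n k) (z : Fin k → ℚ) (s : Fin n → ℚ) (feasible : Feasible D z s)
  (ρ : Fin n) (0<sρ : 0ℚ < s ρ)
  (e : ℚ) (isε : Quantities.IsEpsilon D z s ρ e)
  (ef : Fin n → ℚ) (isεᵢ : Quantities.IsEpsFun D z s ρ ef)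
  (α : Fin n → ℚ) (isα : Quantities.IsAlpha D z s ρ ef α) where

  open Model D
  open Quantities D z s ρ
  open WalkProperties D Mplus
  open RootedProperties D Mplus ρ

  0<ε : 0ℚ < e
  0<ε with proj₂ (proj₂ isε)
  ... | inj₁ (_ , 0<zm , e≡zm) = subst (0ℚ <_) (sym e≡zm) 0<zm
  ... | inj₂ (_ , 0<si , e≡si) = subst (0ℚ <_) (sym e≡si) 0<si

  A0⇒¬Dist0 : ∀ {i} → A0 i → ¬ Dist D Mplus ρ i 0
  A0⇒¬Dist0 i∈A0 ρi = i∈A0 (subst (λ x → 0ℚ < s x) (Dist-zero⇒≡ ρi) 0<sρ)

  ε≤εᵢ≤λᵢ : ∀ {i d} → A0 i → Dist D Mplus ρ i d → e ≤ ef i × ef i ≤ arr i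
  ε≤εᵢ≤λᵢ {d = zero} i∈A0 ρi = ⊥-elim (A0⇒¬Dist0 i∈A0 ρi)
  ε≤εᵢ≤λᵢ {i} {suc d} i∈A0 ρi with Dist-suc⇒closerNeighbour ρi
  ... | p , m , 0<zm , lk , ρp
    rewrite proj₂ isεᵢ i p m i∈A0 ((m , 0<zm , lk) , d , ρp , ρi) 0<zm lk =
    proj₁ isε m 0<zm , match≤arr D feasible lk

  B : ℚ
  B = 1ℚ + recip e

  1≤B : 1ℚ ≤ B
  1≤B = p≤p+q (recip-nonNeg 0<ε)

  weight : Fin n → ℚ
  weight j = α j * (arr j - ef j)

  weight≤ : ∀ {j d P} → A0 j → Dist D Mplus ρ j d → α j ≤ P → 0ℚ ≤ P → weight j ≤ P * arr j
  weight≤ {j} {P = P} j∈A0 ρj αj≤P 0≤P = begin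
      α j * (arr j - ef j)   ≤⟨ ℚₚ.*-monoʳ-≤-nonNeg (arr j - ef j) {{ℚ.nonNegative (p≤q⇒0≤q-p εⱼ≤λⱼ)}} αj≤P ⟩
      P * (arr j - ef j)     ≤⟨ ℚₚ.*-monoˡ-≤-nonNeg P {{ℚ.nonNegative 0≤P}} (0≤q⇒p-q≤p 0≤εⱼ) ⟩
      P * arr j              ∎
    where
    open ℚₚ.≤-Reasoning
    εⱼ≤λⱼ = proj₂ (ε≤εᵢ≤λᵢ j∈A0 ρj)
    0≤εⱼ = ℚₚ.≤-trans (ℚₚ.<⇒≤ 0<ε) (proj₁ (ε≤εᵢ≤λᵢ j∈A0 ρj))

  Bound : ℕ → Set
  Bound d = ∀ i → A0 i → Dist D Mplus ρ i d → α i ≤ pow B ((d ∸ 1) / 2)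

  bound-from-enumeration : ∀ {d} → (∀ {d′} → d′ ℕ.< d → Bound d′) → ∀ {i} → A0 i → Dist D Mplus ρ i d →
    ∀ L → Unique L → (∀ j → (j ∈ L) ⇔ PP i j) → α i ≤ pow B ((d ∸ 1) / 2)
  bound-from-enumeration {d} _ {i} i∈A0 _ [] uniq L⇔PP = begin
      α i                      ≡⟨ isα i i∈A0 [] uniq L⇔PP ⟩
      1ℚ + recip (ef i) * 0ℚ   ≡⟨ cong (1ℚ +_) (ℚₚ.*-zeroʳ (recip (ef i))) ⟩
      1ℚ + 0ℚ                  ≡⟨ ℚₚ.+-identityʳ 1ℚ ⟩
      1ℚ                       ≤⟨ 1≤pow 1≤B ((d ∸ 1) / 2) ⟩
      pow B ((d ∸ 1) / 2)      ∎
    where open ℚₚ.≤-Reasoning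
  bound-from-enumeration {d} ih {i} i∈A0 ρi L@(j₀ ∷ _) uniq L⇔PP = begin
      α i                                 ≡⟨ isα i i∈A0 L uniq L⇔PP ⟩
      1ℚ + recip (ef i) * sumL weight L   ≤⟨ 1+r*s≤[1+c]*p (recip-nonNeg 0<εᵢ) (recip-antimono 0<ε ε≤εᵢ)
                                               weights≤ (1≤pow 1≤B K) ⟩
      pow B (suc K)                       ≡⟨ cong (pow B) (1+[b∸3]/2≡[b∸1]/2 3≤d) ⟩
      pow B ((d ∸ 1) / 2)                 ∎
    where
    open ℚₚ.≤-Reasoning
    K = (d ∸ 3) / 2
    0≤powK = ℚₚ.≤-trans 0≤1 (1≤pow 1≤B K)
    ε≤εᵢ = proj₁ (ε≤εᵢ≤λᵢ i∈A0 ρi)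
    0<εᵢ = ℚₚ.<-≤-trans 0<ε ε≤εᵢ

    L⊆A0 : ∀ {j} → j ∈ L → A0 j
    L⊆A0 {j} j∈L = proj₁ (Equivalence.to (L⇔PP j) j∈L)

    closer : ∀ {j} → j ∈ L → ∃ λ dj → Dist D Mplus ρ j dj × 2 ℕ.+ dj ℕ.≤ d
    closer j∈L with Equivalence.to (L⇔PP _) j∈L
    ... | _ , desc , _ , ji , even = evenProperDesc⇒closer desc ji even ρi

    3≤d : 3 ℕ.≤ d
    3≤d with closer (here refl)
    ... | zero  , ρj , _    = ⊥-elim (A0⇒¬Dist0 (L⊆A0 (here refl)) ρj)
    ... | suc _ , _  , 3+≤d = ℕₚ.≤-trans (s≤s (s≤s (s≤s z≤n))) 3+≤d

    α≤powK : ∀ {j} → j ∈ L → α j ≤ pow B K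
    α≤powK {j} j∈L with closer j∈L
    ... | _ , ρj , 2+dj≤d = ℚₚ.≤-trans
      (ih (ℕₚ.≤-trans (ℕₚ.m≤n+m _ 1) 2+dj≤d) j (L⊆A0 j∈L) ρj)
      (pow-monoʳ-≤ 1≤B ([a∸1]/2≤[b∸3]/2 2+dj≤d))

    weights≤ : sumL weight L ≤ pow B K
    weights≤ = begin
      sumL weight L          ≤⟨ sumL-≤-* weight arr (pow B K) L (λ j∈L →
                                  weight≤ (L⊆A0 j∈L) (proj₁ (proj₂ (closer j∈L))) (α≤powK j∈L) 0≤powK) ⟩
      pow B K * sumL arr L   ≤⟨ ℚₚ.*-monoˡ-≤-nonNeg (pow B K) {{ℚ.nonNegative 0≤powK}}
                                  (sumL≤sumᶠ (ℚₚ.<⇒≤ ∘ arrPos) L uniq) ⟩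
      pow B K * sumᶠ arr     ≡⟨ cong (pow B K *_) arrSum ⟩
      pow B K * 1ℚ           ≡⟨ ℚₚ.*-identityʳ (pow B K) ⟩
      pow B K                ∎

  -- 𝒫(i) need not be decidable, but the goal is; so a decision procedure for 𝒫(i), and with it
  -- the enumeration of 𝒫(i) that IsAlpha speaks about, may be assumed under a double negation.
  α-bound : ∀ d → Bound d
  α-bound = <-rec Bound λ d ih i i∈A0 ρi →
    decidable-stable (α i ℚₚ.≤? pow B ((d ∸ 1) / 2)) (¬¬-map
      (λ PP? → let (L , uniq , L⇔PP) = enumerate PP? in bound-from-enumeration ih i∈A0 ρi L uniq L⇔PP)
      (¬¬-decidable (PP i)))

mainTheorem18 : ∀ (n k : ℕ) (D : Model n k) (z : Fin k → ℚ) (s : Fin n → ℚ) →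
    Optimal D z s → Basic D z s → NonDegenerate D z s →
    IsTree D (λ m → 0ℚ < z m) →
    ∀ (ρ : Fin n) → 0ℚ < s ρ →
    ∀ (e : ℚ) → Quantities.IsEpsilon D z s ρ e →
    ∀ (ef : Fin n → ℚ) → Quantities.IsEpsFun D z s ρ ef →
    ∀ (α : Fin n → ℚ) → Quantities.IsAlpha D z s ρ ef α →
    ∀ (i : Fin n) → Quantities.A0 D z s ρ i →
    ∀ (d : ℕ) → Dist D (λ m → 0ℚ < z m) ρ i d →
    α i ≤ pow (1ℚ + recip e) ((d ∸ 1) / 2)
-- Only feasibility of the optimum is needed: the tree, basicness and non-degeneracy hypotheses
-- serve in the paper to single out the root, which the statement supplies as ρ with s ρ > 0.
mainTheorem18 n k D z s optimal _ _ _ ρ 0<sρ e isε ef isεᵢ α isα i i∈A0 d ρi =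
  AlphaBound.α-bound D z s (proj₁ optimal) ρ 0<sρ e isε ef isεᵢ α isα d i i∈A0 ρi
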